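{- Let $r\geq 1$ and $n\geq r+13$ be integers, and let $G$ be a graph of order $n$ without isolated vertices such that $b(G)<\frac{1}{r}$. Then $$e(G)\leq \binom{n-r-1}{2}+r+1,$$ with equality if and only if $G\cong K_1\vee\big(K_{n-r-2}\cup(r+1)K_1\big)$.
   Context: All graphs are finite and simple; $e(G)$ denotes the number of edges of $G$. For $v\in V(G)$, $N_G(v)$ is its neighborhood and for $S\subseteq V(G)$, $N_G(S)=\bigcup_{v\in S}N_G(v)$. The binding number of $G$ is $$b(G)=\min\Big\{\frac{|N_G(S)|}{|S|}:\emptyset\neq S\subseteq V(G),\ N_G(S)\neq V(G)\Big\}.$$ $G_1\cup G_2$ denotes the disjoint union, $G_1\vee G_2$ the join (disjoint union plus all edges between $V(G_1)$ and $V(G_2)$), $K_m$ the complete graph on $m$ vertices and $sK_1$ the edgeless graph on $s$ vertices. -}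

module Defs where

open import Data.Nat as ℕ using (ℕ; zero; suc; _∸_; _≤ᵇ_; NonZero)
open import Data.Bool using (Bool; true; false; _∧_; _∨_; not; if_then_else_)
open import Data.Fin using (Fin; toℕ; _<_)
open import Data.Fin.Subset using (Subset; ∣_∣; ⊤; inside)
open import Data.Vec using (Vec; tabulate; lookup)
open import Data.Integer using (+_)
open import Data.Rational as ℚ using (ℚ; _/_)
open import Data.Product using (Σ; ∃; _×_)
open import Function.Bundles using (_↔_; Inverse)
open import Relation.Binary.PropositionalEquality using (_≡_; _≢_)
open import Relation.Nullary using (¬_)

record Graph (n : ℕ) : Set where
  field
    adj     : Fin n → Fin n → Bool
    symm    : ∀ u v → adj u v ≡ adj v u
    irrefl  : ∀ v → adj v v ≡ false
open Graph public

anyFin : ∀ {n} → (Fin n → Bool) → Bool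
anyFin {zero}  f = false
anyFin {suc n} f = f Fin.zero ∨ anyFin (λ i → f (Fin.suc i))
  where import Data.Fin as Fin

nbhd : ∀ {n} → Graph n → Subset n → Subset n
nbhd G S = tabulate (λ v → anyFin (λ u → lookup S u ∧ adj G u v))

edges : ∀ {n} → Graph n → ℕ
edges {n} G = sumFin (λ u → ∣ tabulate (λ v → (suc (toℕ u) ≤ᵇ toℕ v) ∧ adj G u v) ∣)
  where
  sumFin : ∀ {m} → (Fin m → ℕ) → ℕ
  sumFin {zero}  f = 0
  sumFin {suc m} f = f Fin.zero ℕ.+ sumFin (λ i → f (Fin.suc i))
    where import Data.Fin as Fin

NoIsolated : ∀ {n} → Graph n → Set
NoIsolated {n} G = ∀ (v : Fin n) → ∃ λ (u : Fin n) → adj G v u ≡ true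

-- S is admissible in the definition of b(G): S nonempty and N_G(S) ≠ V(G).
-- Nonemptiness is recorded as NonZero ∣ S ∣ (needed to form the ratio).
record Admissible {n} (G : Graph n) (S : Subset n) : Set where
  field
    nonempty : NonZero ∣ S ∣
    notAll   : nbhd G S ≢ ⊤
open Admissible public

ratio : ∀ {n} (G : Graph n) (S : Subset n) → Admissible G S → ℚ
ratio G S a = (+ ∣ nbhd G S ∣ / ∣ S ∣) {{nonempty a}}

IsBindingNumber : ∀ {n} → Graph n → ℚ → Set
IsBindingNumber {n} G b =
  (Σ (Subset n) λ S → Σ (Admissible G S) λ a → ratio G S a ≡ b)
  × (∀ (S : Subset n) (a : Admissible G S) → b ℚ.≤ ratio G S a)

_≅_ : ∀ {n} → Graph n → (Fin n → Fin n → Bool) → Set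
_≅_ {n} G H = Σ (Fin n ↔ Fin n) λ f →
  ∀ u v → adj G u v ≡ H (Inverse.to f u) (Inverse.to f v)

-- K₁ ∨ (K_{n-r-2} ∪ (r+1)K₁) on Fin n: vertex 0 is the apex, vertices
-- 1 .. n-r-2 form the clique, vertices n-r-1 .. n-1 are the r+1 pendant vertices.
extremalAdj : (n r : ℕ) → Fin n → Fin n → Bool
extremalAdj n r u v =
  not (toℕ u ℕ.≡ᵇ toℕ v)
  ∧ (isApex (toℕ u) ∨ isApex (toℕ v) ∨ (inClique (toℕ u) ∧ inClique (toℕ v)))
  where
  isApex : ℕ → Bool
  isApex k = k ℕ.≡ᵇ 0
  inClique : ℕ → Bool
  inClique k = (1 ≤ᵇ k) ∧ (k ≤ᵇ (n ∸ r ∸ 2))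

{-# OPTIONS --safe #-}
-- Take S with r |N(S)| < |S| and put P = S ∖ N(S), B = N(S) ∖ S, and let m be the number of
-- remaining vertices. No vertex of S is adjacent to P, so P is independent and N(P) ⊆ B: G is
-- a subgraph of the host graph H(P, B) obtained from K_n by deleting every edge inside P and
-- every edge from P to V ∖ B. Subtracting |S ∩ N(S)| from both sides of r |N(S)| < |S| gives
-- r |B| < |P|, and |B| ≥ 1 because G has no isolated vertex.
-- A direct computation of e(H(P, B)) under these constraints and n ≥ r + 13 gives
-- e(G) ≤ e(H(P, B)) ≤ C(n − r − 1, 2) + r + 1, with equality only if |B| = 1, |P| = r + 1 and
-- G = H(P, B); a permutation moving B to the apex and P to the end identifies H(P, B) with
-- K₁ ∨ (K_{n−r−2} ∪ (r + 1) K₁).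
module Submission where

open import Defs
open import Data.Bool using (Bool; true; false; _∧_; _∨_; not)
open import Data.Bool.Properties using (T-≡; ∧-zeroʳ; ∨-zeroʳ; ∨-identityʳ; not-involutive)
open import Data.Empty using (⊥-elim)
open import Data.Fin using (Fin; zero; suc; toℕ; punchIn; fromℕ<; _≟_)
open import Data.Fin.Permutation as Perm using (Permutation′; _⟨$⟩ʳ_; _⟨$⟩ˡ_)
open import Data.Fin.Properties using (toℕ-fromℕ<; toℕ-injective)
open import Data.Fin.Subset using (Subset; ∣_∣)
open import Data.Integer using (+_)
import Data.Integer.Properties as ℤ
open import Data.Nat using (ℕ; zero; suc; _+_; _*_; _∸_; _≤_; _<_; z≤n; s≤s; _≤ᵇ_; _<ᵇ_; _≡ᵇ_; NonZero)
open import Data.Nat.Combinatorics using (_C_; nCk+nC[k+1]≡[n+1]C[k+1]; nC1≡n)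
open import Data.Nat.Properties hiding (_≟_)
open import Data.Nat.Tactic.RingSolver using (solve-∀)
open import Data.Product using (∃; _×_; _,_; proj₁; proj₂)
open import Data.Rational as ℚ using (ℚ; _/_)
open import Data.Rational.Properties using (toℚᵘ-mono-<; toℚᵘ-fromℚᵘ)
open import Data.Rational.Unnormalised using (mkℚᵘ)
import Data.Rational.Unnormalised.Properties as ℚᵘ
open import Data.Sum using (inj₁; inj₂)
open import Data.Vec using (tabulate; lookup)
open import Data.Vec.Properties using (tabulate∘lookup)
open import Function using (_∘_)
open import Function.Bundles using (_⇔_; mk⇔; Equivalence; Injection)
open import Function.Properties.Inverse using (↔⇒↣)
open import Relation.Binary using (tri<; tri≈; tri>)
open import Relation.Binary.PropositionalEquality
open import Relation.Nullary using (yes; no)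
open import Algebra.Properties.Semiring.Sum +-*-semiring
  using (sum; sum-syntax; sum-cong-≗; ∑-distrib-+; ∑-comm; *-distribˡ-sum; *-distribʳ-sum; sum-permute)

sum-const : ∀ n c → (∑[ i < n ] c) ≡ n * c
sum-const zero    c = refl
sum-const (suc n) c = cong (_+_ c) (sum-const n c)

≤-sum : ∀ {n} (f : Fin n → ℕ) i → f i ≤ sum f
≤-sum f zero    = m≤m+n _ _
≤-sum f (suc i) = ≤-trans (≤-sum (f ∘ suc) i) (m≤n+m _ (f zero))

sum-mono-≤ : ∀ {n} {f g : Fin n → ℕ} → (∀ i → f i ≤ g i) → sum f ≤ sum g
sum-mono-≤ {zero}  f≤g = z≤n
sum-mono-≤ {suc n} f≤g = +-mono-≤ (f≤g zero) (sum-mono-≤ (f≤g ∘ suc))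

sum-mono-< : ∀ {n} {f g : Fin n → ℕ} → (∀ i → f i ≤ g i) → ∀ i → f i < g i → sum f < sum g
sum-mono-< f≤g zero    f0<g0 = +-mono-<-≤ f0<g0 (sum-mono-≤ (f≤g ∘ suc))
sum-mono-< f≤g (suc i) fi<gi = +-mono-≤-< (f≤g zero) (sum-mono-< (f≤g ∘ suc) i fi<gi)

sum-mono-≤-≡⇒≗ : ∀ {n} {f g : Fin n → ℕ} → (∀ i → f i ≤ g i) → sum f ≡ sum g → ∀ i → f i ≡ g i
sum-mono-≤-≡⇒≗ f≤g sum≡ i with m≤n⇒m<n∨m≡n (f≤g i)
... | inj₁ fi<gi = ⊥-elim (<⇒≢ (sum-mono-< f≤g i fi<gi) sum≡)
... | inj₂ fi≡gi = fi≡gi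

sum-positive : ∀ {n} (f : Fin n → ℕ) → 0 < sum f → ∃ λ i → 0 < f i
sum-positive {suc n} f pos with f zero in eq
... | suc _ = zero , subst (0 <_) (sym eq) (s≤s z≤n)
... | zero  = let i , fi>0 = sum-positive (f ∘ suc) pos in suc i , fi>0

⟦_⟧ : Bool → ℕ
⟦ true ⟧  = 1
⟦ false ⟧ = 0

⟦⟧≤1 : ∀ b → ⟦ b ⟧ ≤ 1
⟦⟧≤1 true  = ≤-refl
⟦⟧≤1 false = z≤n

⟦⟧-injective : ∀ {a b} → ⟦ a ⟧ ≡ ⟦ b ⟧ → a ≡ b
⟦⟧-injective {true}  {true}  _ = refl
⟦⟧-injective {false} {false} _ = refl

⟦⟧-split : ∀ e a → ⟦ a ⟧ ≡ ⟦ not e ∧ a ⟧ + ⟦ e ⟧ * ⟦ a ⟧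
⟦⟧-split true  true  = refl
⟦⟧-split true  false = refl
⟦⟧-split false true  = refl
⟦⟧-split false false = refl

sum-diagonal : ∀ {n} (u : Fin n) (g : Fin n → ℕ) → ∑[ v < n ] (⟦ toℕ u ≡ᵇ toℕ v ⟧ * g v) ≡ g u
sum-diagonal {suc n} zero    g = begin
  (g zero + 0) + ∑[ v < n ] 0 ≡⟨ cong₂ _+_ (+-identityʳ (g zero)) (sum-const n 0) ⟩
  g zero + n * 0              ≡⟨ cong (_+_ (g zero)) (*-zeroʳ n) ⟩
  g zero + 0                  ≡⟨ +-identityʳ (g zero) ⟩
  g zero                      ∎
  where open ≡-Reasoning
sum-diagonal {suc n} (suc u) g = sum-diagonal u (g ∘ suc)

count : ∀ {n} → (Fin n → Bool) → ℕ
count {n} P = ∑[ i < n ] ⟦ P i ⟧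

count≤n : ∀ {n} (P : Fin n → Bool) → count P ≤ n
count≤n {n} P = begin
  count P      ≤⟨ sum-mono-≤ (⟦⟧≤1 ∘ P) ⟩
  ∑[ i < n ] 1 ≡⟨ sum-const n 1 ⟩
  n * 1        ≡⟨ *-identityʳ n ⟩
  n            ∎
  where open ≤-Reasoning

true⇒count>0 : ∀ {n} (P : Fin n → Bool) {u} → P u ≡ true → 0 < count P
true⇒count>0 P {u} Pu = ≤-trans (≤-reflexive (cong ⟦_⟧ (sym Pu))) (≤-sum (⟦_⟧ ∘ P) u)

count>0⇒true : ∀ {n} (P : Fin n → Bool) → 0 < count P → ∃ λ u → P u ≡ true
count>0⇒true P pos with sum-positive (⟦_⟧ ∘ P) pos
... | u , ⟦Pu⟧>0 = u , ⟦⟧>0 ⟦Pu⟧>0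
  where
  ⟦⟧>0 : ∀ {b} → 0 < ⟦ b ⟧ → b ≡ true
  ⟦⟧>0 {true} _ = refl

∣tabulate∣≡count : ∀ {n} (P : Fin n → Bool) → ∣ tabulate P ∣ ≡ count P
∣tabulate∣≡count {zero}  P = refl
∣tabulate∣≡count {suc n} P with P zero
... | true  = cong suc (∣tabulate∣≡count (P ∘ suc))
... | false = ∣tabulate∣≡count (P ∘ suc)

count-≥ : ∀ {n} k → count {n} (λ x → k ≤ᵇ toℕ x) ≡ n ∸ k
count-≥ {zero}  k       = sym (0∸n≡0 k)
count-≥ {suc n} zero    = cong suc (count-≥ {n} zero)
count-≥ {suc n} (suc k) = trans (sum-cong-≗ {n} (cong ⟦_⟧ ∘ suc-≤ᵇ-suc k ∘ toℕ)) (count-≥ {n} k)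
  where
  suc-≤ᵇ-suc : ∀ k t → (suc k ≤ᵇ suc t) ≡ (k ≤ᵇ t)
  suc-≤ᵇ-suc zero    t = refl
  suc-≤ᵇ-suc (suc k) t = refl

count-≡ᵇ0 : ∀ {n} → count {suc n} (λ x → toℕ x ≡ᵇ 0) ≡ 1
count-≡ᵇ0 {n} = cong suc (trans (sum-const n 0) (*-zeroʳ n))

punchIn-<ᵇ : ∀ {n} (j : Fin (suc n)) (y : Fin n) → (toℕ (punchIn j y) <ᵇ toℕ j) ≡ (toℕ y <ᵇ toℕ j)
punchIn-<ᵇ zero    y       = refl
punchIn-<ᵇ (suc j) zero    = refl
punchIn-<ᵇ (suc j) (suc y) = punchIn-<ᵇ j y

<ᵇ-irrefl : ∀ k → (k <ᵇ k) ≡ false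
<ᵇ-irrefl zero    = refl
<ᵇ-irrefl (suc k) = <ᵇ-irrefl k

prefix-permutation : ∀ {n} (Q : Fin n → Bool) →
  ∃ λ (π : Permutation′ n) → ∀ u → Q u ≡ (toℕ (π ⟨$⟩ʳ u) <ᵇ count Q)
prefix-permutation {zero}  Q = Perm.id , λ ()
prefix-permutation {suc n} Q with prefix-permutation (Q ∘ suc) | Q zero in Q0
... | π , Q∘suc≗ | true  = Perm.insert zero zero π , moved
  where
  moved : ∀ u → Q u ≡ (toℕ (Perm.insert zero zero π ⟨$⟩ʳ u) <ᵇ suc (count (Q ∘ suc)))
  moved zero    = Q0
  moved (suc i) rewrite Perm.insert-punchIn zero zero π i = Q∘suc≗ i
... | π , Q∘suc≗ | false = Perm.insert zero j π , moved
  where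
  k : ℕ
  k = count (Q ∘ suc)
  j : Fin (suc n)
  j = fromℕ< (s≤s (count≤n (Q ∘ suc)))
  toℕj≡k : toℕ j ≡ k
  toℕj≡k = toℕ-fromℕ< _
  moved : ∀ u → Q u ≡ (toℕ (Perm.insert zero j π ⟨$⟩ʳ u) <ᵇ k)
  moved zero    = begin
    Q zero            ≡⟨ Q0 ⟩
    false             ≡⟨ <ᵇ-irrefl (toℕ j) ⟨
    toℕ j <ᵇ toℕ j    ≡⟨ cong (toℕ j <ᵇ_) toℕj≡k ⟩
    toℕ j <ᵇ k        ∎
    where open ≡-Reasoning
  moved (suc i) rewrite Perm.insert-punchIn zero j π i = begin
    Q (suc i)                           ≡⟨ Q∘suc≗ i ⟩
    toℕ (π ⟨$⟩ʳ i) <ᵇ k                 ≡⟨ cong (toℕ (π ⟨$⟩ʳ i) <ᵇ_) toℕj≡k ⟨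
    toℕ (π ⟨$⟩ʳ i) <ᵇ toℕ j             ≡⟨ punchIn-<ᵇ j (π ⟨$⟩ʳ i) ⟨
    toℕ (punchIn j (π ⟨$⟩ʳ i)) <ᵇ toℕ j ≡⟨ cong (toℕ (punchIn j (π ⟨$⟩ʳ i)) <ᵇ_) toℕj≡k ⟩
    toℕ (punchIn j (π ⟨$⟩ʳ i)) <ᵇ k     ∎
    where open ≡-Reasoning

≡⇒toℕ-≡ᵇ : ∀ {n} {u v : Fin n} → u ≡ v → (toℕ u ≡ᵇ toℕ v) ≡ true
≡⇒toℕ-≡ᵇ {u = u} refl = Equivalence.to T-≡ (≡⇒≡ᵇ (toℕ u) (toℕ u) refl)

≢⇒toℕ-≡ᵇ : ∀ {n} {u v : Fin n} → u ≢ v → (toℕ u ≡ᵇ toℕ v) ≡ false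
≢⇒toℕ-≡ᵇ {u = u} {v} u≢v with toℕ u ≡ᵇ toℕ v in eq
... | false = refl
... | true  = ⊥-elim (u≢v (toℕ-injective (≡ᵇ⇒≡ (toℕ u) (toℕ v) (Equivalence.from T-≡ eq))))

toℕ-≡ᵇ-permute : ∀ {n} (σ : Permutation′ n) u v → (toℕ u ≡ᵇ toℕ v) ≡ (toℕ (σ ⟨$⟩ʳ u) ≡ᵇ toℕ (σ ⟨$⟩ʳ v))
toℕ-≡ᵇ-permute σ u v with u ≟ v
... | yes u≡v = trans (≡⇒toℕ-≡ᵇ u≡v) (sym (≡⇒toℕ-≡ᵇ (cong (σ ⟨$⟩ʳ_) u≡v)))
... | no u≢v  = trans (≢⇒toℕ-≡ᵇ u≢v) (sym (≢⇒toℕ-≡ᵇ (u≢v ∘ Injection.injective (↔⇒↣ σ))))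

degreeSum : ∀ {n} → (Fin n → Fin n → Bool) → ℕ
degreeSum {n} H = ∑[ u < n ] ∑[ v < n ] ⟦ H u v ⟧

degreeSum-cong : ∀ {n} {H H′ : Fin n → Fin n → Bool} → (∀ u v → H u v ≡ H′ u v) → degreeSum H ≡ degreeSum H′
degreeSum-cong H≡H′ = sum-cong-≗ (λ u → sum-cong-≗ (cong ⟦_⟧ ∘ H≡H′ u))

degreeSum-mono : ∀ {n} {H H′ : Fin n → Fin n → Bool} →
  (∀ u v → ⟦ H u v ⟧ ≤ ⟦ H′ u v ⟧) → degreeSum H ≤ degreeSum H′
degreeSum-mono H≤H′ = sum-mono-≤ (λ u → sum-mono-≤ (H≤H′ u))

degreeSum-mono-≡⇒≗ : ∀ {n} {H H′ : Fin n → Fin n → Bool} →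
  (∀ u v → ⟦ H u v ⟧ ≤ ⟦ H′ u v ⟧) → degreeSum H ≡ degreeSum H′ → ∀ u v → H u v ≡ H′ u v
degreeSum-mono-≡⇒≗ H≤H′ eq u v = ⟦⟧-injective
  (sum-mono-≤-≡⇒≗ (H≤H′ u) (sum-mono-≤-≡⇒≗ (λ u → sum-mono-≤ (H≤H′ u)) eq u) v)

degreeSum-≅ : ∀ {n} (G : Graph n) {H : Fin n → Fin n → Bool} → G ≅ H → degreeSum (adj G) ≡ degreeSum H
degreeSum-≅ {n} G {H} (π , adj≡H∘π) = begin
  degreeSum (adj G)                                   ≡⟨ degreeSum-cong adj≡H∘π ⟩
  ∑[ u < n ] ∑[ v < n ] ⟦ H (π ⟨$⟩ʳ u) (π ⟨$⟩ʳ v) ⟧ ≡⟨ sum-cong-≗ (λ u → sum-permute (λ y → ⟦ H (π ⟨$⟩ʳ u) y ⟧) π) ⟨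
  ∑[ u < n ] ∑[ y < n ] ⟦ H (π ⟨$⟩ʳ u) y ⟧           ≡⟨ sum-permute (λ x → ∑[ y < n ] ⟦ H x y ⟧) π ⟨
  degreeSum H                                         ∎
  where open ≡-Reasoning

_≺_ : ∀ {n} → Fin n → Fin n → Bool
u ≺ v = suc (toℕ u) ≤ᵇ toℕ v

dropFirst : ∀ {n} → Graph (suc n) → Graph n
dropFirst G = record
  { adj    = λ u v → adj G (suc u) (suc v)
  ; symm   = λ u v → symm G (suc u) (suc v)
  ; irrefl = λ v → irrefl G (suc v)
  }

-- edges sums over a local recursion that can only be unfolded one vertex at a time,
-- through the graph on the remaining vertices.
edges≡∑count : ∀ {n} (G : Graph n) → edges G ≡ ∑[ u < n ] count (λ v → u ≺ v ∧ adj G u v)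
edges≡∑count {zero}  G = refl
edges≡∑count {suc n} G =
  cong₂ _+_ (∣tabulate∣≡count {suc n} (λ v → zero ≺ v ∧ adj G zero v)) (edges≡∑count (dropFirst G))

≤ᵇ-true : ∀ {m n} → m ≤ n → (m ≤ᵇ n) ≡ true
≤ᵇ-true m≤n = Equivalence.to T-≡ (≤⇒≤ᵇ m≤n)

≤ᵇ-false : ∀ {m n} → n < m → (m ≤ᵇ n) ≡ false
≤ᵇ-false {m} {n} n<m with m ≤ᵇ n in eq
... | false = refl
... | true  = ⊥-elim (<⇒≱ n<m (≤ᵇ⇒≤ m n (Equivalence.from T-≡ eq)))

adj-split : ∀ {n} (G : Graph n) u v →
  ⟦ adj G u v ⟧ ≡ ⟦ u ≺ v ∧ adj G u v ⟧ + ⟦ v ≺ u ∧ adj G v u ⟧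
adj-split G u v with <-cmp (toℕ u) (toℕ v)
... | tri< u<v _ _ rewrite ≤ᵇ-true u<v | ≤ᵇ-false {suc (toℕ v)} (s≤s (<⇒≤ u<v)) = sym (+-identityʳ _)
... | tri> _ _ v<u rewrite ≤ᵇ-true v<u | ≤ᵇ-false {suc (toℕ u)} (s≤s (<⇒≤ v<u)) | symm G u v = refl
... | tri≈ _ u≡v _ rewrite toℕ-injective u≡v | irrefl G v | ∧-zeroʳ (v ≺ v) = refl

handshake : ∀ {n} (G : Graph n) → degreeSum (adj G) ≡ 2 * edges G
handshake {n} G = begin
  degreeSum (adj G)
    ≡⟨ sum-cong-≗ (λ u → trans (sum-cong-≗ (adj-split G u)) (∑-distrib-+ (ordered u) (λ v → ordered v u))) ⟩
  ∑[ u < n ] (∑[ v < n ] ordered u v + ∑[ v < n ] ordered v u)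
    ≡⟨ ∑-distrib-+ (λ u → ∑[ v < n ] ordered u v) (λ u → ∑[ v < n ] ordered v u) ⟩
  ∑[ u < n ] ∑[ v < n ] ordered u v + ∑[ u < n ] ∑[ v < n ] ordered v u
    ≡⟨ cong (_+_ (∑[ u < n ] ∑[ v < n ] ordered u v)) (∑-comm (λ u v → ordered v u)) ⟩
  ∑[ u < n ] ∑[ v < n ] ordered u v + ∑[ v < n ] ∑[ u < n ] ordered v u
    ≡⟨ cong₂ _+_ (sym (edges≡∑count G)) (trans (sym (edges≡∑count G)) (sym (+-identityʳ (edges G)))) ⟩
  edges G + (edges G + 0) ∎
  where
  open ≡-Reasoning
  ordered : Fin n → Fin n → ℕ
  ordered u v = ⟦ u ≺ v ∧ adj G u v ⟧

-- The host graph H(P, B)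

allowed : ∀ {n} → (P B : Fin n → Bool) → Fin n → Fin n → Bool
allowed P B u v = (not (P u) ∨ B v) ∧ (not (P v) ∨ B u)

hostAdj : ∀ {n} → (P B : Fin n → Bool) → Fin n → Fin n → Bool
hostAdj P B u v = not (toℕ u ≡ᵇ toℕ v) ∧ allowed P B u v

-- 2 e(H(P, B)) + b + m: the vertices of P have degree b, those of B degree p + b + m − 1 and
-- the remaining ones degree b + m − 1; adding one for each vertex outside P avoids truncated
-- subtraction.
hostDegreeSum : ℕ → ℕ → ℕ → ℕ
hostDegreeSum p b m = p * b + (p + b + m) * b + m * (b + m)

module HostGraph {n} (P B : Fin n → Bool) (P∧B≡false : ∀ u → P u ∧ B u ≡ false) where

  M : Fin n → Bool
  M u = not (P u) ∧ not (B u)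

  p b m : ℕ
  p = count P
  b = count B
  m = count M

  private
    partition : ∀ pu bu → pu ∧ bu ≡ false → 1 ≡ ⟦ pu ⟧ + ⟦ bu ⟧ + ⟦ not pu ∧ not bu ⟧
    partition true  false _ = refl
    partition false true  _ = refl
    partition false false _ = refl

    not-split : ∀ pu bu → pu ∧ bu ≡ false → ⟦ not pu ⟧ ≡ ⟦ bu ⟧ + ⟦ not pu ∧ not bu ⟧
    not-split true  false _ = refl
    not-split false true  _ = refl
    not-split false false _ = refl

    allowed-diagonal : ∀ pu bu → pu ∧ bu ≡ false → ⟦ (not pu ∨ bu) ∧ (not pu ∨ bu) ⟧ ≡ ⟦ not pu ⟧
    allowed-diagonal true  false _ = refl
    allowed-diagonal false true  _ = refl
    allowed-diagonal false false _ = refl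

    allowed-split : ∀ pu bu pv bv → pu ∧ bu ≡ false → pv ∧ bv ≡ false →
      ⟦ (not pu ∨ bv) ∧ (not pv ∨ bu) ⟧ ≡ ⟦ pu ⟧ * ⟦ bv ⟧ + ⟦ bu ⟧ + ⟦ not pu ∧ not bu ⟧ * ⟦ not pv ⟧
    allowed-split true  false true  false _ _ = refl
    allowed-split true  false false true  _ _ = refl
    allowed-split true  false false false _ _ = refl
    allowed-split false true  true  false _ _ = refl
    allowed-split false true  false true  _ _ = refl
    allowed-split false true  false false _ _ = refl
    allowed-split false false true  false _ _ = refl
    allowed-split false false false true  _ _ = refl
    allowed-split false false false false _ _ = refl

  n≡p+b+m : n ≡ p + b + m
  n≡p+b+m = begin
    n                                        ≡⟨ *-identityʳ n ⟨
    n * 1                                    ≡⟨ sum-const n 1 ⟨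
    ∑[ u < n ] 1                             ≡⟨ sum-cong-≗ (λ u → partition (P u) (B u) (P∧B≡false u)) ⟩
    ∑[ u < n ] (⟦ P u ⟧ + ⟦ B u ⟧ + ⟦ M u ⟧) ≡⟨ ∑-distrib-+ (λ u → ⟦ P u ⟧ + ⟦ B u ⟧) (⟦_⟧ ∘ M) ⟩
    ∑[ u < n ] (⟦ P u ⟧ + ⟦ B u ⟧) + m       ≡⟨ cong (_+ m) (∑-distrib-+ (⟦_⟧ ∘ P) (⟦_⟧ ∘ B)) ⟩
    p + b + m                                ∎
    where open ≡-Reasoning

  count-notP : count (not ∘ P) ≡ b + m
  count-notP = trans (sum-cong-≗ (λ u → not-split (P u) (B u) (P∧B≡false u))) (∑-distrib-+ (⟦_⟧ ∘ B) (⟦_⟧ ∘ M))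

  allowed-row : ∀ u → ∑[ v < n ] ⟦ allowed P B u v ⟧ ≡ ⟦ P u ⟧ * b + n * ⟦ B u ⟧ + ⟦ M u ⟧ * (b + m)
  allowed-row u = begin
    ∑[ v < n ] ⟦ allowed P B u v ⟧
      ≡⟨ sum-cong-≗ (λ v → allowed-split (P u) (B u) (P v) (B v) (P∧B≡false u) (P∧B≡false v)) ⟩
    ∑[ v < n ] (⟦ P u ⟧ * ⟦ B v ⟧ + ⟦ B u ⟧ + ⟦ M u ⟧ * ⟦ not (P v) ⟧)
      ≡⟨ ∑-distrib-+ (λ v → ⟦ P u ⟧ * ⟦ B v ⟧ + ⟦ B u ⟧) (λ v → ⟦ M u ⟧ * ⟦ not (P v) ⟧) ⟩
    ∑[ v < n ] (⟦ P u ⟧ * ⟦ B v ⟧ + ⟦ B u ⟧) + ∑[ v < n ] (⟦ M u ⟧ * ⟦ not (P v) ⟧)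
      ≡⟨ cong₂ _+_ (∑-distrib-+ (λ v → ⟦ P u ⟧ * ⟦ B v ⟧) (λ _ → ⟦ B u ⟧))
                   (sym (*-distribˡ-sum ⟦ M u ⟧ (⟦_⟧ ∘ not ∘ P))) ⟩
    ∑[ v < n ] (⟦ P u ⟧ * ⟦ B v ⟧) + ∑[ v < n ] ⟦ B u ⟧ + ⟦ M u ⟧ * count (not ∘ P)
      ≡⟨ cong₂ _+_ (cong₂ _+_ (sym (*-distribˡ-sum ⟦ P u ⟧ (⟦_⟧ ∘ B))) (sum-const n ⟦ B u ⟧))
                   (cong (⟦ M u ⟧ *_) count-notP) ⟩
    ⟦ P u ⟧ * b + n * ⟦ B u ⟧ + ⟦ M u ⟧ * (b + m) ∎
    where open ≡-Reasoning

  hostAdj-row : ∀ u → ∑[ v < n ] ⟦ hostAdj P B u v ⟧ + ⟦ not (P u) ⟧ ≡ ∑[ v < n ] ⟦ allowed P B u v ⟧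
  hostAdj-row u = begin
    ∑[ v < n ] ⟦ hostAdj P B u v ⟧ + ⟦ not (P u) ⟧
      ≡⟨ cong (_+_ (∑[ v < n ] ⟦ hostAdj P B u v ⟧)) diagonal ⟨
    ∑[ v < n ] ⟦ hostAdj P B u v ⟧ + ∑[ v < n ] (⟦ u ≈ v ⟧ * ⟦ allowed P B u v ⟧)
      ≡⟨ ∑-distrib-+ (⟦_⟧ ∘ hostAdj P B u) (λ v → ⟦ u ≈ v ⟧ * ⟦ allowed P B u v ⟧) ⟨
    ∑[ v < n ] (⟦ hostAdj P B u v ⟧ + ⟦ u ≈ v ⟧ * ⟦ allowed P B u v ⟧)
      ≡⟨ sum-cong-≗ (λ v → ⟦⟧-split (u ≈ v) (allowed P B u v)) ⟨
    ∑[ v < n ] ⟦ allowed P B u v ⟧ ∎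
    where
    open ≡-Reasoning
    _≈_ : Fin n → Fin n → Bool
    u ≈ v = toℕ u ≡ᵇ toℕ v
    diagonal : ∑[ v < n ] (⟦ u ≈ v ⟧ * ⟦ allowed P B u v ⟧) ≡ ⟦ not (P u) ⟧
    diagonal = trans (sum-diagonal u (⟦_⟧ ∘ allowed P B u)) (allowed-diagonal (P u) (B u) (P∧B≡false u))

  degreeSum-hostAdj : degreeSum (hostAdj P B) + (b + m) ≡ hostDegreeSum p b m
  degreeSum-hostAdj = begin
    degreeSum (hostAdj P B) + (b + m)
      ≡⟨ cong (_+_ (degreeSum (hostAdj P B))) count-notP ⟨
    degreeSum (hostAdj P B) + count (not ∘ P)
      ≡⟨ ∑-distrib-+ (λ u → ∑[ v < n ] ⟦ hostAdj P B u v ⟧) (⟦_⟧ ∘ not ∘ P) ⟨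
    ∑[ u < n ] (∑[ v < n ] ⟦ hostAdj P B u v ⟧ + ⟦ not (P u) ⟧)
      ≡⟨ sum-cong-≗ (λ u → trans (hostAdj-row u) (allowed-row u)) ⟩
    ∑[ u < n ] (⟦ P u ⟧ * b + n * ⟦ B u ⟧ + ⟦ M u ⟧ * (b + m))
      ≡⟨ ∑-distrib-+ (λ u → ⟦ P u ⟧ * b + n * ⟦ B u ⟧) (λ u → ⟦ M u ⟧ * (b + m)) ⟩
    ∑[ u < n ] (⟦ P u ⟧ * b + n * ⟦ B u ⟧) + ∑[ u < n ] (⟦ M u ⟧ * (b + m))
      ≡⟨ cong₂ _+_ (∑-distrib-+ (λ u → ⟦ P u ⟧ * b) (λ u → n * ⟦ B u ⟧)) (sym (*-distribʳ-sum (b + m) (⟦_⟧ ∘ M))) ⟩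
    ∑[ u < n ] (⟦ P u ⟧ * b) + ∑[ u < n ] (n * ⟦ B u ⟧) + m * (b + m)
      ≡⟨ cong (_+ m * (b + m)) (cong₂ _+_ (sym (*-distribʳ-sum b (⟦_⟧ ∘ P))) (sym (*-distribˡ-sum n (⟦_⟧ ∘ B)))) ⟩
    p * b + n * b + m * (b + m)
      ≡⟨ cong (λ k → p * b + k * b + m * (b + m)) n≡p+b+m ⟩
    hostDegreeSum p b m ∎
    where open ≡-Reasoning

⇒-true : ∀ {a b} → (a ≡ true → b ≡ true) → (not a ∨ b) ≡ true
⇒-true {true}  a⇒b = a⇒b refl
⇒-true {false} a⇒b = refl

adj⇒≢ : ∀ {n} (G : Graph n) {u v} → adj G u v ≡ true → u ≢ v
adj⇒≢ G {u} uv refl with () ← trans (sym uv) (irrefl G u)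

adj⊆hostAdj : ∀ {n} (G : Graph n) (P B : Fin n → Bool) →
  (∀ {u v} → P u ≡ true → adj G u v ≡ true → B v ≡ true) → ∀ u v → ⟦ adj G u v ⟧ ≤ ⟦ hostAdj P B u v ⟧
adj⊆hostAdj G P B P-adj⇒B u v with adj G u v in uv
... | false = z≤n
... | true rewrite ≢⇒toℕ-≡ᵇ (adj⇒≢ G uv) | ⇒-true (λ Pu → P-adj⇒B Pu uv)
                 | ⇒-true (λ Pv → P-adj⇒B Pv (trans (symm G v u) uv)) = ≤-refl

hostAdj-permute : ∀ {n} (σ : Permutation′ n) {P B P₀ B₀ : Fin n → Bool} →
  (∀ u → P u ≡ P₀ (σ ⟨$⟩ʳ u)) → (∀ u → B u ≡ B₀ (σ ⟨$⟩ʳ u)) →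
  ∀ u v → hostAdj P B u v ≡ hostAdj P₀ B₀ (σ ⟨$⟩ʳ u) (σ ⟨$⟩ʳ v)
hostAdj-permute σ P≡ B≡ u v rewrite toℕ-≡ᵇ-permute σ u v | P≡ u | P≡ v | B≡ u | B≡ v = refl

anyFin-intro : ∀ {n} (f : Fin n → Bool) u → f u ≡ true → anyFin f ≡ true
anyFin-intro f zero    fu rewrite fu = refl
anyFin-intro f (suc u) fu with f zero
... | true  = refl
... | false = anyFin-intro (f ∘ suc) u fu

module Neighbourhood {n} (G : Graph n) (S : Subset n) where

  inS inN : Fin n → Bool
  inS = lookup S
  inN v = anyFin (λ u → lookup S u ∧ adj G u v)

  inN-intro : ∀ {u v} → inS u ≡ true → adj G u v ≡ true → inN v ≡ true
  inN-intro {u} Su uv = anyFin-intro _ u (cong₂ _∧_ Su uv)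

  P B : Fin n → Bool
  P u = inS u ∧ not (inN u)
  B u = inN u ∧ not (inS u)

  P∧B≡false : ∀ u → P u ∧ B u ≡ false
  P∧B≡false u with inS u | inN u
  ... | true  | true  = refl
  ... | true  | false = refl
  ... | false | _     = refl

  P-adj⇒B : ∀ {u v} → P u ≡ true → adj G u v ≡ true → B v ≡ true
  P-adj⇒B {u} Pu uv with inS u in Su | inN u in Nu
  P-adj⇒B () uv | false | _
  P-adj⇒B () uv | true  | true
  P-adj⇒B {u} {v} _ uv | true | false with inS v in Sv
  ... | false rewrite inN-intro Su uv = refl
  ... | true with () ← trans (sym (inN-intro Sv (trans (symm G v u) uv))) Nu

  open HostGraph P B P∧B≡false public

  a : ℕ
  a = count (λ u → inS u ∧ inN u)

  count-inS : count inS ≡ a + p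
  count-inS = trans (sum-cong-≗ (λ u → split (inS u) (inN u))) (∑-distrib-+ _ (⟦_⟧ ∘ P))
    where
    split : ∀ s t → ⟦ s ⟧ ≡ ⟦ s ∧ t ⟧ + ⟦ s ∧ not t ⟧
    split true  true  = refl
    split true  false = refl
    split false _     = refl

  count-inN : count inN ≡ a + b
  count-inN = trans (sum-cong-≗ (λ u → split (inS u) (inN u))) (∑-distrib-+ _ (⟦_⟧ ∘ B))
    where
    split : ∀ s t → ⟦ t ⟧ ≡ ⟦ s ∧ t ⟧ + ⟦ t ∧ not s ⟧
    split true  true  = refl
    split false true  = refl
    split true  false = refl
    split false false = refl

  r*∣N[S]∣<∣S∣⇒r*b<p : ∀ r .{{_ : NonZero r}} → r * ∣ nbhd G S ∣ < ∣ S ∣ → r * b < p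
  r*∣N[S]∣<∣S∣⇒r*b<p r r*N<S = +-cancelˡ-< a (r * b) p (begin-strict
    a + r * b        ≤⟨ +-monoˡ-≤ (r * b) (m≤n*m a r) ⟩
    r * a + r * b    ≡⟨ *-distribˡ-+ r a b ⟨
    r * (a + b)      ≡⟨ cong (r *_) (trans (∣tabulate∣≡count inN) count-inN) ⟨
    r * ∣ nbhd G S ∣ <⟨ r*N<S ⟩
    ∣ S ∣            ≡⟨ cong ∣_∣ (tabulate∘lookup S) ⟨
    ∣ tabulate inS ∣ ≡⟨ trans (∣tabulate∣≡count inS) count-inS ⟩
    a + p            ∎)
    where open ≤-Reasoning

  b-positive : NoIsolated G → 0 < p → 0 < b
  b-positive noIsolated p>0 with count>0⇒true P p>0
  ... | u , Pu with noIsolated u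
  ...   | v , uv = true⇒count>0 B (P-adj⇒B Pu uv)

-- The arithmetic of the bound

extremalBound : ℕ → ℕ → ℕ
extremalBound n r = (n ∸ r ∸ 1) C 2 + r + 1

2*[nC2]+n≡n*n : ∀ n → 2 * (n C 2) + n ≡ n * n
2*[nC2]+n≡n*n zero    = refl
2*[nC2]+n≡n*n (suc n) = begin
  2 * (suc n C 2) + suc n       ≡⟨ cong (λ c → 2 * c + suc n) (nCk+nC[k+1]≡[n+1]C[k+1] n 1) ⟨
  2 * (n C 1 + n C 2) + suc n   ≡⟨ cong (λ c → 2 * (c + n C 2) + suc n) (nC1≡n n) ⟩
  2 * (n + n C 2) + suc n       ≡⟨ regroup n (n C 2) ⟩
  (2 * (n C 2) + n) + 2 * n + 1 ≡⟨ cong (λ s → s + 2 * n + 1) (2*[nC2]+n≡n*n n) ⟩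
  n * n + 2 * n + 1             ≡⟨ square n ⟩
  suc n * suc n                 ∎
  where
  open ≡-Reasoning
  regroup : ∀ n c → 2 * (n + c) + suc n ≡ (2 * c + n) + 2 * n + 1
  regroup = solve-∀
  square : ∀ n → n * n + 2 * n + 1 ≡ suc n * suc n
  square = solve-∀

module Slack (r : ℕ) .{{_ : NonZero r}} (b′ x : ℕ) where

  z slack : ℕ
  z = r * b′ + x
  slack = 3 * (r * b′) + x + 2 * b′

  slack≤5z : slack ≤ 5 * z
  slack≤5z = begin
    3 * (r * b′) + x + 2 * b′               ≤⟨ +-monoʳ-≤ (3 * (r * b′) + x) (*-monoʳ-≤ 2 (m≤n*m b′ r)) ⟩
    3 * (r * b′) + x + 2 * (r * b′)         ≤⟨ m≤m+n _ (4 * x) ⟩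
    3 * (r * b′) + x + 2 * (r * b′) + 4 * x ≡⟨ regroup (r * b′) x ⟩
    5 * z                                   ∎
    where
    open ≤-Reasoning
    regroup : ∀ u x → 3 * u + x + 2 * u + 4 * x ≡ 5 * (u + x)
    regroup = solve-∀

  module _ (m : ℕ) (12≤N : 12 ≤ z + suc b′ + m) where

    6≤z+2m : 6 ≤ z + 2 * m
    6≤z+2m = *-cancelˡ-< 2 5 (z + 2 * m) (≤-pred (≤-trans 12≤N (begin
      z + suc b′ + m        ≤⟨ +-monoˡ-≤ m (+-monoʳ-≤ z (s≤s (≤-trans (m≤n*m b′ r) (m≤m+n (r * b′) x)))) ⟩
      z + suc z + m         ≤⟨ m≤m+n _ (3 * m) ⟩
      z + suc z + m + 3 * m ≡⟨ regroup z m ⟩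
      suc (2 * (z + 2 * m)) ∎)))
      where
      open ≤-Reasoning
      regroup : ∀ z m → z + suc z + m + 3 * m ≡ suc (2 * (z + 2 * m))
      regroup = solve-∀

    6z≤z*[z+2m] : 6 * z ≤ z * (z + 2 * m)
    6z≤z*[z+2m] = ≤-trans (*-monoˡ-≤ z 6≤z+2m) (≤-reflexive (*-comm (z + 2 * m) z))

    slack≤z*[z+2m] : slack ≤ z * (z + 2 * m)
    slack≤z*[z+2m] = ≤-trans slack≤5z (≤-trans (*-monoˡ-≤ z (n≤1+n 5)) 6z≤z*[z+2m])

    slack≡z*[z+2m]⇒z≡0 : slack ≡ z * (z + 2 * m) → z ≡ 0
    slack≡z*[z+2m]⇒z≡0 slack≡ = n≤0⇒n≡0 (+-cancelʳ-≤ (5 * z) z 0 (begin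
      6 * z           ≤⟨ 6z≤z*[z+2m] ⟩
      z * (z + 2 * m) ≡⟨ slack≡ ⟨
      slack           ≤⟨ slack≤5z ⟩
      5 * z           ∎))
      where open ≤-Reasoning

n≡r+1+N : ∀ r b′ x m → suc (r * suc b′ + x) + suc b′ + m ≡ r + suc (r * b′ + x + suc b′ + m)
n≡r+1+N = solve-∀

-- Writing b = 1 + b′ and p = 1 + r b + x, the bound exceeds hostDegreeSum by
-- z (z + 2 m) − slack with z = r b′ + x; this is nonnegative once n ≥ r + 13 and vanishes only
-- for z = 0, that is b = 1 and p = r + 1.
hostDegreeSum-slack : ∀ r b′ x m → let b = suc b′ ; p = suc (r * b + x) ; z = r * b′ + x in
  hostDegreeSum p b m + z * (z + 2 * m) ≡ 2 * extremalBound (p + b + m) r + (b + m) + (3 * (r * b′) + x + 2 * b′)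
hostDegreeSum-slack r b′ x m = +-cancelʳ-≡ N _ _ (begin
  W + z * (z + 2 * m) + N             ≡⟨ polynomial r b′ x m ⟩
  N * N + 2 * r + 2 + q + K           ≡⟨ cong (λ s → s + 2 * r + 2 + q + K) (2*[nC2]+n≡n*n N) ⟨
  2 * (N C 2) + N + 2 * r + 2 + q + K ≡⟨ regroup (N C 2) N r q K ⟩
  2 * (N C 2 + r + 1) + q + K + N     ≡⟨ cong (λ k → 2 * (k C 2 + r + 1) + q + K + N) n∸r∸1≡N ⟨
  2 * extremalBound n r + q + K + N   ∎)
  where
  open ≡-Reasoning
  b p n q z N W K : ℕ
  b = suc b′
  p = suc (r * b + x)
  n = p + b + m
  q = b + m
  z = r * b′ + x
  N = z + b + m
  W = hostDegreeSum p b m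
  K = 3 * (r * b′) + x + 2 * b′
  polynomial : ∀ r b′ x m →
    let b = suc b′ ; p = suc (r * b + x) ; z = r * b′ + x ; N = z + b + m in
    p * b + (p + b + m) * b + m * (b + m) + z * (z + 2 * m) + N
    ≡ N * N + 2 * r + 2 + (b + m) + (3 * (r * b′) + x + 2 * b′)
  polynomial = solve-∀
  regroup : ∀ c N r q K → 2 * c + N + 2 * r + 2 + q + K ≡ 2 * (c + r + 1) + q + K + N
  regroup = solve-∀
  n∸r∸1≡N : n ∸ r ∸ 1 ≡ N
  n∸r∸1≡N = cong (_∸ 1) (trans (cong (_∸ r) (n≡r+1+N r b′ x m)) (m+n∸m≡n r (suc N)))

data Decomposition (r : ℕ) : ℕ → ℕ → Set where
  decompose : ∀ b′ x → Decomposition r (suc (r * suc b′ + x)) (suc b′)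

decomposition : ∀ r {p b} → 0 < b → r * b < p → Decomposition r p b
decomposition r {b = suc b′} _ r*b<p with m≤n⇒∃[o]m+o≡n r*b<p
... | x , refl = decompose b′ x

r+13≤n⇒12≤N : ∀ r b′ x m → r + 13 ≤ suc (r * suc b′ + x) + suc b′ + m → 12 ≤ r * b′ + x + suc b′ + m
r+13≤n⇒12≤N r b′ x m r+13≤n = ≤-pred (+-cancelˡ-≤ r 13 _ (≤-trans r+13≤n (≤-reflexive (n≡r+1+N r b′ x m))))

module _ (r : ℕ) .{{_ : NonZero r}} {p b m : ℕ} (b>0 : 0 < b) (r*b<p : r * b < p) (r+13≤n : r + 13 ≤ p + b + m) where

  hostDegreeSum-bound : hostDegreeSum p b m ≤ 2 * extremalBound (p + b + m) r + (b + m)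
  hostDegreeSum-bound with decomposition r b>0 r*b<p
  ... | decompose b′ x = +-cancelʳ-≤ (z * (z + 2 * m)) _ _ (begin
    hostDegreeSum p b m + z * (z + 2 * m)                       ≡⟨ hostDegreeSum-slack r b′ x m ⟩
    2 * extremalBound (p + b + m) r + (b + m) + slack           ≤⟨ +-monoʳ-≤ _ (slack≤z*[z+2m] m 12≤N) ⟩
    2 * extremalBound (p + b + m) r + (b + m) + z * (z + 2 * m) ∎)
    where
    open ≤-Reasoning
    open Slack r b′ x
    12≤N : 12 ≤ z + suc b′ + m
    12≤N = r+13≤n⇒12≤N r b′ x m r+13≤n

  hostDegreeSum-bound-≡ : hostDegreeSum p b m ≡ 2 * extremalBound (p + b + m) r + (b + m) → b ≡ 1 × p ≡ suc r
  hostDegreeSum-bound-≡ W≡ with decomposition r b>0 r*b<p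
  ... | decompose b′ x = cong suc b′≡0 , cong suc (trans (cong₂ (λ c y → r * suc c + y) b′≡0 x≡0) r*1+0≡r)
    where
    open Slack r b′ x
    z≡0 : z ≡ 0
    z≡0 = slack≡z*[z+2m]⇒z≡0 m (r+13≤n⇒12≤N r b′ x m r+13≤n)
      (+-cancelˡ-≡ _ _ _ (trans (sym (hostDegreeSum-slack r b′ x m)) (cong (_+ z * (z + 2 * m)) W≡)))
    x≡0 : x ≡ 0
    x≡0 = m+n≡0⇒n≡0 (r * b′) z≡0
    b′≡0 : b′ ≡ 0
    b′≡0 = *-cancelˡ-≡ b′ 0 r (trans (m+n≡0⇒m≡0 (r * b′) z≡0) (sym (*-zeroʳ r)))
    r*1+0≡r : r * 1 + 0 ≡ r
    r*1+0≡r = trans (+-identityʳ (r * 1)) (*-identityʳ r)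

hostDegreeSum-extremal : ∀ r m → hostDegreeSum (suc r) 1 m ≡ 2 * extremalBound (suc r + 1 + m) r + (1 + m)
hostDegreeSum-extremal r m = begin
  hostDegreeSum (suc r) 1 m                         ≡⟨ cong (λ k → hostDegreeSum (suc k) 1 m) r*1+0≡r ⟨
  W                                                 ≡⟨ +-identityʳ W ⟨
  W + 0                                             ≡⟨ cong (λ k → W + k * (k + 2 * m)) r*0+0≡0 ⟨
  W + (r * 0 + 0) * (r * 0 + 0 + 2 * m)             ≡⟨ hostDegreeSum-slack r 0 0 m ⟩
  2 * extremalBound (suc (r * 1 + 0) + 1 + m) r + (1 + m) + (3 * (r * 0) + 0 + 2 * 0)
    ≡⟨ cong₂ (λ k j → 2 * extremalBound (suc k + 1 + m) r + (1 + m) + (3 * j + 0 + 0)) r*1+0≡r (*-zeroʳ r) ⟩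
  2 * extremalBound (suc r + 1 + m) r + (1 + m) + 0 ≡⟨ +-identityʳ _ ⟩
  2 * extremalBound (suc r + 1 + m) r + (1 + m)     ∎
  where
  open ≡-Reasoning
  W : ℕ
  W = hostDegreeSum (suc (r * 1 + 0)) 1 m
  r*1+0≡r : r * 1 + 0 ≡ r
  r*1+0≡r = trans (+-identityʳ (r * 1)) (*-identityʳ r)
  r*0+0≡0 : r * 0 + 0 ≡ 0
  r*0+0≡0 = trans (+-identityʳ (r * 0)) (*-zeroʳ r)

module _ (r : ℕ) where

  1+r+1+m∸r∸2≡m : ∀ m → suc r + 1 + m ∸ r ∸ 2 ≡ m
  1+r+1+m∸r∸2≡m m = cong (_∸ 2) (trans (cong (_∸ r) (regroup r m)) (m+n∸m≡n r (2 + m)))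
    where
    regroup : ∀ r m → suc r + 1 + m ≡ r + (2 + m)
    regroup = solve-∀

  1+r+1+m∸[1+m]≡1+r : ∀ m → suc r + 1 + m ∸ suc m ≡ suc r
  1+r+1+m∸[1+m]≡1+r m = trans (cong (_∸ suc m) (+-assoc (suc r) 1 m)) (m+n∸n≡m (suc r) (suc m))

-- The extremal graph K₁ ∨ (K_{n−r−2} ∪ (r + 1) K₁)

apex : ∀ {n} → Fin n → Bool
apex x = toℕ x ≡ᵇ 0

pendant : ∀ {n} → ℕ → Fin n → Bool
pendant L x = L <ᵇ toℕ x

pendant∧apex≡false : ∀ {n} L (u : Fin n) → pendant L u ∧ apex u ≡ false
pendant∧apex≡false L u with toℕ u
... | zero  = refl
... | suc _ = ∧-zeroʳ (L <ᵇ suc _)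

<ᵇ-suc-not : ∀ k t → (k <ᵇ suc t) ≡ not (t <ᵇ k)
<ᵇ-suc-not zero    t       = refl
<ᵇ-suc-not (suc k) zero    = refl
<ᵇ-suc-not (suc k) (suc t) = <ᵇ-suc-not k t

extremalAdj≡hostAdj : ∀ n r x y → extremalAdj n r x y ≡ hostAdj (pendant (n ∸ r ∸ 2)) apex x y
extremalAdj≡hostAdj n r x y = cong (not (toℕ x ≡ᵇ toℕ y) ∧_) (core (toℕ x) (toℕ y))
  where
  L : ℕ
  L = n ∸ r ∸ 2
  core : ∀ i j → ((i ≡ᵇ 0) ∨ (j ≡ᵇ 0) ∨ (((1 ≤ᵇ i) ∧ (i ≤ᵇ L)) ∧ ((1 ≤ᵇ j) ∧ (j ≤ᵇ L))))
               ≡ (not (L <ᵇ i) ∨ (j ≡ᵇ 0)) ∧ (not (L <ᵇ j) ∨ (i ≡ᵇ 0))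
  core zero    zero    = refl
  core zero    (suc j) rewrite ∨-zeroʳ (not (L <ᵇ suc j)) = refl
  core (suc i) zero    rewrite ∨-zeroʳ (not (L <ᵇ suc i)) = refl
  core (suc i) (suc j) rewrite ∨-identityʳ (not (L <ᵇ suc i)) | ∨-identityʳ (not (L <ᵇ suc j))
    | <ᵇ-suc-not L i | <ᵇ-suc-not L j | not-involutive (i <ᵇ L) | not-involutive (j <ᵇ L) = refl

≅extremal⇒edges≡extremalBound : ∀ r {n} → suc r + 1 ≤ n → (G : Graph n) → G ≅ extremalAdj n r →
  edges G ≡ extremalBound n r
≅extremal⇒edges≡extremalBound r 2+r≤n G G≅extremal with m≤n⇒∃[o]m+o≡n 2+r≤n
... | k , refl = *-cancelˡ-≡ (edges G) (extremalBound n r) 2 (+-cancelʳ-≡ (1 + m) _ _ (begin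
  2 * edges G + (1 + m)                         ≡⟨ cong (_+ (1 + m)) (handshake G) ⟨
  degreeSum (adj G) + (1 + m)                   ≡⟨ cong (_+ (1 + m)) (degreeSum-≅ G {extremalAdj n r} G≅extremal) ⟩
  degreeSum (extremalAdj n r) + (1 + m)         ≡⟨ cong (_+ (1 + m)) (degreeSum-cong (extremalAdj≡hostAdj n r)) ⟩
  degreeSum (hostAdj P₀ apex) + (1 + m)         ≡⟨ cong (λ b → degreeSum (hostAdj P₀ apex) + (b + m)) b₀≡1 ⟨
  degreeSum (hostAdj P₀ apex) + (b₀ + m)        ≡⟨ degreeSum-hostAdj ⟩
  hostDegreeSum p₀ b₀ m                         ≡⟨ cong₂ (λ p b → hostDegreeSum p b m) p₀≡1+r b₀≡1 ⟩
  hostDegreeSum (suc r) 1 m                     ≡⟨ hostDegreeSum-extremal r m ⟩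
  2 * extremalBound (suc r + 1 + m) r + (1 + m) ≡⟨ cong (λ n → 2 * extremalBound n r + (1 + m)) n≡1+r+1+m ⟨
  2 * extremalBound n r + (1 + m)               ∎))
  where
  open ≡-Reasoning
  n : ℕ
  n = suc r + 1 + k
  P₀ : Fin n → Bool
  P₀ = pendant (n ∸ r ∸ 2)
  open HostGraph P₀ apex (pendant∧apex≡false (n ∸ r ∸ 2)) renaming (p to p₀; b to b₀)
  p₀≡1+r : p₀ ≡ suc r
  p₀≡1+r = trans (count-≥ {n} (suc (n ∸ r ∸ 2)))
                 (trans (cong (λ j → n ∸ suc j) (1+r+1+m∸r∸2≡m r k)) (1+r+1+m∸[1+m]≡1+r r k))
  b₀≡1 : b₀ ≡ 1
  b₀≡1 = count-≡ᵇ0 {r + 1 + k}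
  n≡1+r+1+m : n ≡ suc r + 1 + m
  n≡1+r+1+m = trans n≡p+b+m (cong₂ (λ p b → p + b + m) p₀≡1+r b₀≡1)

∧≡false⇒≡false : ∀ {a b} → a ∧ b ≡ false → b ≡ true → a ≡ false
∧≡false⇒≡false {false} _ _ = refl
∧≡false⇒≡false {true} a∧b≡false refl with () ← a∧b≡false

-- π₁ moves the unique vertex of B to 0; π₂ then sorts the other vertices so that those
-- outside P come first.
module ApexPendant {n} (P B : Fin (suc n) → Bool) (P∧B≡false : ∀ u → P u ∧ B u ≡ false) {m : ℕ}
                   (count-B≡1 : count B ≡ 1) (count-notP≡1+m : count (not ∘ P) ≡ suc m) where

  private
    π₁ : Permutation′ (suc n)
    π₁ = proj₁ (prefix-permutation B)

    B≡π₁<1 : ∀ u → B u ≡ (toℕ (π₁ ⟨$⟩ʳ u) <ᵇ 1)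
    B≡π₁<1 u = trans (proj₂ (prefix-permutation B) u) (cong (toℕ (π₁ ⟨$⟩ʳ u) <ᵇ_) count-B≡1)

    notP-rest : Fin n → Bool
    notP-rest x = not (P (π₁ ⟨$⟩ˡ suc x))

    P-first≡false : P (π₁ ⟨$⟩ˡ zero) ≡ false
    P-first≡false = ∧≡false⇒≡false (P∧B≡false _) (trans (B≡π₁<1 _) (cong (λ w → toℕ w <ᵇ 1) (Perm.inverseʳ π₁)))

    count-notP-rest : count notP-rest ≡ m
    count-notP-rest = suc-injective (begin
      suc (count notP-rest)                  ≡⟨ cong (λ t → ⟦ not t ⟧ + count notP-rest) P-first≡false ⟨
      ∑[ x < suc n ] ⟦ not (P (π₁ ⟨$⟩ˡ x)) ⟧ ≡⟨ sum-permute (⟦_⟧ ∘ not ∘ P) (Perm.flip π₁) ⟨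
      count (not ∘ P)                        ≡⟨ count-notP≡1+m ⟩
      suc m                                  ∎)
      where open ≡-Reasoning

    π₂ : Permutation′ n
    π₂ = proj₁ (prefix-permutation notP-rest)

    notP-rest≡π₂<m : ∀ x → notP-rest x ≡ (toℕ (π₂ ⟨$⟩ʳ x) <ᵇ m)
    notP-rest≡π₂<m x = trans (proj₂ (prefix-permutation notP-rest) x) (cong (toℕ (π₂ ⟨$⟩ʳ x) <ᵇ_) count-notP-rest)

  σ : Permutation′ (suc n)
  σ = π₁ Perm.∘ₚ Perm.lift₀ π₂

  B≡apex∘σ : ∀ u → B u ≡ apex (σ ⟨$⟩ʳ u)
  B≡apex∘σ u with π₁ ⟨$⟩ʳ u | B≡π₁<1 u
  ... | zero  | B≡ = B≡
  ... | suc _ | B≡ = B≡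

  P≡pendant∘σ : ∀ u → P u ≡ pendant m (σ ⟨$⟩ʳ u)
  P≡pendant∘σ u with π₁ ⟨$⟩ʳ u in π₁u
  ... | zero  = ∧≡false⇒≡false (P∧B≡false u) (trans (B≡π₁<1 u) (cong (λ w → toℕ w <ᵇ 1) π₁u))
  ... | suc x = begin
    P u                        ≡⟨ not-involutive (P u) ⟨
    not (not (P u))            ≡⟨ cong (not ∘ not ∘ P) u≡π₁⁻¹[1+x] ⟩
    not (notP-rest x)          ≡⟨ cong not (notP-rest≡π₂<m x) ⟩
    not (toℕ (π₂ ⟨$⟩ʳ x) <ᵇ m) ≡⟨ <ᵇ-suc-not m (toℕ (π₂ ⟨$⟩ʳ x)) ⟨
    m <ᵇ suc (toℕ (π₂ ⟨$⟩ʳ x)) ∎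
    where
    open ≡-Reasoning
    u≡π₁⁻¹[1+x] : u ≡ π₁ ⟨$⟩ˡ suc x
    u≡π₁⁻¹[1+x] = trans (sym (Perm.inverseˡ π₁)) (cong (π₁ ⟨$⟩ˡ_) π₁u)

apex-pendant-permutation : ∀ {n} (P B : Fin n → Bool) → (∀ u → P u ∧ B u ≡ false) → ∀ {m} →
  count B ≡ 1 → count (not ∘ P) ≡ suc m →
  ∃ λ (σ : Permutation′ n) → (∀ u → P u ≡ pendant m (σ ⟨$⟩ʳ u)) × (∀ u → B u ≡ apex (σ ⟨$⟩ʳ u))
apex-pendant-permutation {zero}  P B _ ()
apex-pendant-permutation {suc n} P B P∧B≡false count-B≡1 count-notP≡1+m = σ , P≡pendant∘σ , B≡apex∘σ
  where open ApexPendant P B P∧B≡false count-B≡1 count-notP≡1+m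

-- The bound and its equality case

/-<-/⇒*-< : ∀ a s b r .{{_ : NonZero s}} .{{_ : NonZero r}} → (+ a / s) ℚ.< (+ b / r) → a * r < b * s
/-<-/⇒*-< a (suc s) b (suc r) a/s<b/r = ℤ.+◃-cancel-< (ℚᵘ.drop-*<*
  (ℚᵘ.<-respˡ-≃ (toℚᵘ-fromℚᵘ (mkℚᵘ (+ a) s)) (ℚᵘ.<-respʳ-≃ (toℚᵘ-fromℚᵘ (mkℚᵘ (+ b) r)) (toℚᵘ-mono-< a/s<b/r))))

module _ {n} (r : ℕ) .{{_ : NonZero r}} (r+13≤n : r + 13 ≤ n) (G : Graph n) (noIsolated : NoIsolated G)
         (S : Subset n) (r*∣N[S]∣<∣S∣ : r * ∣ nbhd G S ∣ < ∣ S ∣) where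

  open Neighbourhood G S

  private
    r*b<p : r * b < p
    r*b<p = r*∣N[S]∣<∣S∣⇒r*b<p r r*∣N[S]∣<∣S∣

    b>0 : 0 < b
    b>0 = b-positive noIsolated (≤-trans (s≤s z≤n) r*b<p)

    r+13≤p+b+m : r + 13 ≤ p + b + m
    r+13≤p+b+m = subst (r + 13 ≤_) n≡p+b+m r+13≤n

    2e+q≤W : 2 * edges G + (b + m) ≤ hostDegreeSum p b m
    2e+q≤W = begin
      2 * edges G + (b + m)             ≡⟨ cong (_+ (b + m)) (handshake G) ⟨
      degreeSum (adj G) + (b + m)       ≤⟨ +-monoˡ-≤ (b + m) (degreeSum-mono (adj⊆hostAdj G P B P-adj⇒B)) ⟩
      degreeSum (hostAdj P B) + (b + m) ≡⟨ degreeSum-hostAdj ⟩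
      hostDegreeSum p b m               ∎
      where open ≤-Reasoning

    W≤2T+q : hostDegreeSum p b m ≤ 2 * extremalBound n r + (b + m)
    W≤2T+q = subst (λ k → hostDegreeSum p b m ≤ 2 * extremalBound k r + (b + m)) (sym n≡p+b+m)
                   (hostDegreeSum-bound r b>0 r*b<p r+13≤p+b+m)

  edges≤extremalBound : edges G ≤ extremalBound n r
  edges≤extremalBound = *-cancelˡ-≤ 2 (+-cancelʳ-≤ (b + m) _ _ (≤-trans 2e+q≤W W≤2T+q))

  private
    module Tight (e≡T : edges G ≡ extremalBound n r) where

      2e+q≡W : 2 * edges G + (b + m) ≡ hostDegreeSum p b m
      2e+q≡W = ≤-antisym 2e+q≤W (≤-trans W≤2T+q (≤-reflexive (cong (λ e → 2 * e + (b + m)) (sym e≡T))))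

      b≡1×p≡1+r : b ≡ 1 × p ≡ suc r
      b≡1×p≡1+r = hostDegreeSum-bound-≡ r b>0 r*b<p r+13≤p+b+m
        (subst (λ k → hostDegreeSum p b m ≡ 2 * extremalBound k r + (b + m)) n≡p+b+m
               (trans (sym 2e+q≡W) (cong (λ e → 2 * e + (b + m)) e≡T)))

      b≡1 : b ≡ 1
      b≡1 = proj₁ b≡1×p≡1+r
      p≡1+r : p ≡ suc r
      p≡1+r = proj₂ b≡1×p≡1+r

      adj≡hostAdj : ∀ u v → adj G u v ≡ hostAdj P B u v
      adj≡hostAdj = degreeSum-mono-≡⇒≗ (adj⊆hostAdj G P B P-adj⇒B) (+-cancelʳ-≡ (b + m) _ _ (begin
        degreeSum (adj G) + (b + m)       ≡⟨ cong (_+ (b + m)) (handshake G) ⟩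
        2 * edges G + (b + m)             ≡⟨ 2e+q≡W ⟩
        hostDegreeSum p b m               ≡⟨ degreeSum-hostAdj ⟨
        degreeSum (hostAdj P B) + (b + m) ∎))
        where open ≡-Reasoning

      n∸r∸2≡m : n ∸ r ∸ 2 ≡ m
      n∸r∸2≡m = trans (cong (λ k → k ∸ r ∸ 2) (trans n≡p+b+m (cong₂ (λ p b → p + b + m) p≡1+r b≡1)))
                      (1+r+1+m∸r∸2≡m r m)

      permutation : ∃ λ (σ : Permutation′ n) → (∀ u → P u ≡ pendant m (σ ⟨$⟩ʳ u)) × (∀ u → B u ≡ apex (σ ⟨$⟩ʳ u))
      permutation = apex-pendant-permutation P B P∧B≡false b≡1 (trans count-notP (cong (_+ m) b≡1))

      σ : Permutation′ n
      σ = proj₁ permutation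
      P≡pendant∘σ : ∀ u → P u ≡ pendant m (σ ⟨$⟩ʳ u)
      P≡pendant∘σ = proj₁ (proj₂ permutation)
      B≡apex∘σ : ∀ u → B u ≡ apex (σ ⟨$⟩ʳ u)
      B≡apex∘σ = proj₂ (proj₂ permutation)

  edges≡extremalBound⇒≅extremal : edges G ≡ extremalBound n r → G ≅ extremalAdj n r
  edges≡extremalBound⇒≅extremal e≡T = σ , λ u v → begin
    adj G u v                                                ≡⟨ adj≡hostAdj u v ⟩
    hostAdj P B u v                                          ≡⟨ hostAdj-permute σ {P₀ = pendant m} {B₀ = apex} P≡pendant∘σ B≡apex∘σ u v ⟩
    hostAdj (pendant m) apex (σ ⟨$⟩ʳ u) (σ ⟨$⟩ʳ v)           ≡⟨ cong (λ L → hostAdj (pendant L) apex (σ ⟨$⟩ʳ u) (σ ⟨$⟩ʳ v)) n∸r∸2≡m ⟨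
    hostAdj (pendant (n ∸ r ∸ 2)) apex (σ ⟨$⟩ʳ u) (σ ⟨$⟩ʳ v) ≡⟨ extremalAdj≡hostAdj n r (σ ⟨$⟩ʳ u) (σ ⟨$⟩ʳ v) ⟨
    extremalAdj n r (σ ⟨$⟩ʳ u) (σ ⟨$⟩ʳ v)                    ∎
    where
    open ≡-Reasoning
    open Tight e≡T

theorem1p4 : (r n : ℕ) .{{_ : NonZero r}} → r + 13 ≤ n →
    (G : Graph n) → NoIsolated G →
    (∃ λ (b : ℚ) → IsBindingNumber G b × b ℚ.< (+ 1 / r)) →
    (edges G ≤ ((n ∸ r ∸ 1) C 2) + r + 1)
    × ((edges G ≡ ((n ∸ r ∸ 1) C 2) + r + 1) ⇔ (G ≅ extremalAdj n r))
theorem1p4 r n r+13≤n G noIsolated (β , ((S , admissible , ratio≡β) , _) , β<1/r) =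
  edges≤extremalBound r r+13≤n G noIsolated S r*∣N[S]∣<∣S∣ ,
  mk⇔ (edges≡extremalBound⇒≅extremal r r+13≤n G noIsolated S r*∣N[S]∣<∣S∣)
      (≅extremal⇒edges≡extremalBound r 2+r≤n G)
  where
  r*∣N[S]∣<∣S∣ : r * ∣ nbhd G S ∣ < ∣ S ∣
  r*∣N[S]∣<∣S∣ = subst₂ _<_ (*-comm ∣ nbhd G S ∣ r) (*-identityˡ ∣ S ∣)
    (/-<-/⇒*-< ∣ nbhd G S ∣ ∣ S ∣ 1 r {{nonempty admissible}} (subst (ℚ._< (+ 1 / r)) (sym ratio≡β) β<1/r))
  2+r≤n : suc r + 1 ≤ n
  2+r≤n = ≤-trans (≤-reflexive (sym (+-suc r 1))) (≤-trans (+-monoʳ-≤ r (s≤s (s≤s z≤n))) r+13≤n)
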